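{- For every integer $n\ge 3$, $\gamma_{oiR}(P_{n}\Box C_{3})=\lceil \frac{7n}{3}\rceil$.
   Context: All graphs are simple and undirected. $P_n$ denotes the path on $n$ vertices and $C_m$ the cycle on $m$ vertices; $P_n\Box C_m$ is their Cartesian product, with vertex set $\{v_{i,j}: 0\le i\le n-1,\ 0\le j\le m-1\}$, where $v_{i,j}$ and $v_{i',j'}$ are adjacent iff either $i=i'$ and $j'\equiv j\pm1 \pmod m$, or $j=j'$ and $|i-i'|=1$. For a graph $G=(V,E)$, an outer independent Roman dominating function (OIRDF) is a function $f:V\to\{0,1,2\}$ such that every vertex $u$ with $f(u)=0$ has a neighbour $v$ with $f(v)=2$, and the set $V_0=\{u\in V: f(u)=0\}$ is an independent set. The weight of $f$ is $w(f)=\sum_{v\in V}f(v)$, and $\gamma_{oiR}(G)$ is the minimum weight of an OIRDF of $G$. -}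

module Defs where

open import Data.Nat using (ℕ; _+_; _*_; _≤_; _/_)
open import Data.Fin using (Fin; toℕ; zero; suc)
open import Data.Product using (_×_; _,_; Σ; ∃; proj₁; proj₂)
open import Data.Sum using (_⊎_)
open import Data.Empty using (⊥)
open import Relation.Nullary using (¬_)
open import Relation.Binary.PropositionalEquality using (_≡_)

∑ : (k : ℕ) → (Fin k → ℕ) → ℕ
∑ ℕ.zero    g = 0
∑ (ℕ.suc k) g = g zero + ∑ k (λ i → g (suc i))

Vertex : ℕ → ℕ → Set
Vertex n m = Fin n × Fin m

-- j' ≡ j ± 1 (mod m), stated on natural-number representatives.
CycAdj : (m : ℕ) → Fin m → Fin m → Set
CycAdj m j j' = (ℕ.suc (toℕ j) ≡ toℕ j' ⊎ ℕ.suc (toℕ j') ≡ toℕ j)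
              ⊎ ((ℕ.suc (toℕ j) ≡ m × toℕ j' ≡ 0) ⊎ (ℕ.suc (toℕ j') ≡ m × toℕ j ≡ 0))

PathAdj : (n : ℕ) → Fin n → Fin n → Set
PathAdj n i i' = ℕ.suc (toℕ i) ≡ toℕ i' ⊎ ℕ.suc (toℕ i') ≡ toℕ i

Adj : (n m : ℕ) → Vertex n m → Vertex n m → Set
Adj n m (i , j) (i' , j') = (i ≡ i' × CycAdj m j j') ⊎ (j ≡ j' × PathAdj n i i')

-- Outer independent Roman dominating function on P_n □ C_m
-- (values in {0,1,2} as a function into ℕ bounded by 2).
record IsOIRDF (n m : ℕ) (f : Vertex n m → ℕ) : Set where
  field
    bounded     : ∀ u → f u ≤ 2
    dominated   : ∀ u → f u ≡ 0 → ∃ λ v → Adj n m u v × f v ≡ 2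
    independent : ∀ u v → f u ≡ 0 → f v ≡ 0 → ¬ Adj n m u v

weight : (n m : ℕ) → (Vertex n m → ℕ) → ℕ
weight n m f = ∑ n (λ i → ∑ m (λ j → f (i , j)))

γoiR-is : (n m : ℕ) → ℕ → Set
γoiR-is n m k =
  (Σ (Vertex n m → ℕ) λ f → IsOIRDF n m f × weight n m f ≡ k)
  × (∀ f → IsOIRDF n m f → k ≤ weight n m f)

ceil3 : ℕ → ℕ
ceil3 a = (a + 2) / 3

-- Lower bound: the zeros of a column form an independent set in the triangle C₃, so
-- every column has weight at least 2, and a column of weight 2 contains a 0 that must
-- be dominated from a neighbouring column, which then holds a 2 and weighs at least 3.
-- So every column has positive excess (weight minus 2) in itself or a neighbour, and
-- double counting gives n ≤ 3 · (total excess), i.e. 3 · weight ≥ 6n + n.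
-- Upper bound: repeat blocks of three columns of weights 2, 3, 2, where the 2 in the
-- middle column dominates the zeros of both outer columns.

module Submission where

open import Defs
open import Data.Nat using (ℕ; zero; suc; _+_; _*_; _∸_; _≤_; _<_; z≤n; s≤s; _≟_; _≤?_; _<?_)
open import Data.Nat.Properties
open import Data.Nat.DivMod using (m<n*o⇒m/o<n; m*n/n≡m; /-monoˡ-≤)
open import Data.Nat.Tactic.RingSolver using (solve-∀)
open import Algebra.Properties.CommutativeSemigroup +-commutativeSemigroup using (interchange; x∙yz≈y∙xz; x∙yz≈z∙xy)
open import Data.Fin as Fin using (Fin; toℕ; fromℕ<; inject₁)
open import Data.Fin.Properties using (toℕ<n; toℕ-fromℕ<; fromℕ<-toℕ; toℕ-inject₁; all?; any?)
open import Data.Product using (_×_; _,_; ∃)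
open import Data.Sum using (_⊎_; inj₁; inj₂)
open import Data.Empty using (⊥; ⊥-elim)
open import Relation.Nullary using (¬_; yes; no; ¬?)
open import Relation.Nullary.Decidable using (from-yes; _×-dec_; _→-dec_)
open import Relation.Binary.PropositionalEquality
open import Function using (_∘_; id)

∑-cong : ∀ k {g h : Fin k → ℕ} → (∀ i → g i ≡ h i) → ∑ k g ≡ ∑ k h
∑-cong zero    g≡h = refl
∑-cong (suc k) g≡h = cong₂ _+_ (g≡h Fin.zero) (∑-cong k (λ i → g≡h (Fin.suc i)))

∑-mono-≤ : ∀ k {g h : Fin k → ℕ} → (∀ i → g i ≤ h i) → ∑ k g ≤ ∑ k h
∑-mono-≤ zero    g≤h = z≤n
∑-mono-≤ (suc k) g≤h = +-mono-≤ (g≤h Fin.zero) (∑-mono-≤ k (λ i → g≤h (Fin.suc i)))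

∑-+ : ∀ k (g h : Fin k → ℕ) → ∑ k (λ i → g i + h i) ≡ ∑ k g + ∑ k h
∑-+ zero    g h = refl
∑-+ (suc k) g h = trans (cong (g Fin.zero + h Fin.zero +_) (∑-+ k (g ∘ Fin.suc) (h ∘ Fin.suc)))
                        (interchange (g Fin.zero) (h Fin.zero) _ _)

∑-const : ∀ k c → ∑ k (λ _ → c) ≡ k * c
∑-const zero    c = refl
∑-const (suc k) c = cong (c +_) (∑-const k c)

∑< : ℕ → (ℕ → ℕ) → ℕ
∑< n h = ∑ n (λ i → h (toℕ i))

∑<-suc : ∀ n h → ∑< (suc n) h ≡ ∑< n h + h n
∑<-suc zero    h = +-comm (h 0) 0
∑<-suc (suc n) h = trans (cong (h 0 +_) (∑<-suc n (λ a → h (suc a)))) (sym (+-assoc (h 0) _ _))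

∑<-≤-suc : ∀ n h → ∑< n h ≤ ∑< (suc n) h
∑<-≤-suc n h = subst (∑< n h ≤_) (sym (∑<-suc n h)) (m≤m+n _ _)

previous : (ℕ → ℕ) → ℕ → ℕ
previous e zero    = 0
previous e (suc a) = e a

around : (ℕ → ℕ) → ℕ → ℕ
around e a = previous e a + (e a + e (suc a))

∑<-previous : ∀ n e → ∑< n (previous e) ≤ ∑< (suc n) e
∑<-previous zero    e = z≤n
∑<-previous (suc n) e = ≤-trans (∑<-≤-suc n e) (∑<-≤-suc (suc n) e)

∑<-around : ∀ n e → ∑< n (around e) ≤ 3 * ∑< (suc n) e
∑<-around n e = begin
  ∑< n (around e)                                     ≡⟨ ∑-+ n _ _ ⟩
  ∑< n (previous e) + ∑< n (λ a → e a + e (suc a))    ≡⟨ cong (∑< n (previous e) +_) (∑-+ n _ _) ⟩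
  ∑< n (previous e) + (∑< n e + ∑< n (λ a → e (suc a)))
    ≤⟨ +-mono-≤ (∑<-previous n e) (+-mono-≤ (∑<-≤-suc n e) (m≤n+m _ (e 0))) ⟩
  S + (S + S)                                         ≡⟨ cong (λ t → S + (S + t)) (sym (+-identityʳ S)) ⟩
  3 * S                                               ∎
  where
  open ≤-Reasoning
  S = ∑< (suc n) e

around-self : ∀ e a → 1 ≤ e a → 1 ≤ around e a
around-self e a p = ≤-trans p (≤-trans (m≤m+n (e a) _) (m≤n+m _ (previous e a)))

around-next : ∀ e a → 1 ≤ e (suc a) → 1 ≤ around e a
around-next e a p = ≤-trans p (≤-trans (m≤n+m _ (e a)) (m≤n+m _ (previous e a)))

around-previous : ∀ e a → 1 ≤ e a → 1 ≤ around e (suc a)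
around-previous e a p = ≤-trans p (m≤m+n (e a) _)

-- Double counting: each value e a occurs in at most three of the sums around e b.
n≤3*∑< : ∀ n e → (∀ (i : Fin n) → 1 ≤ around e (toℕ i)) → n ≤ 3 * ∑< (suc n) e
n≤3*∑< n e local = begin
  n                   ≡⟨ sym (*-identityʳ n) ⟩
  n * 1               ≡⟨ sym (∑-const n 1) ⟩
  ∑< n (λ _ → 1)      ≤⟨ ∑-mono-≤ n local ⟩
  ∑< n (around e)     ≤⟨ ∑<-around n e ⟩
  3 * ∑< (suc n) e    ∎
  where open ≤-Reasoning

7*n≤3*∑< : ∀ n (c : ℕ → ℕ) → c n ≤ 2 → (∀ (i : Fin n) → 2 ≤ c (toℕ i)) →
           (∀ (i : Fin n) → 1 ≤ around (λ a → c a ∸ 2) (toℕ i)) → 7 * n ≤ 3 * ∑< n c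
7*n≤3*∑< n c cₙ≤2 c≥2 local = begin
  7 * n                       ≡⟨ split n ⟩
  3 * (n * 2) + n             ≤⟨ +-monoʳ-≤ (3 * (n * 2)) (n≤3*∑< n e local) ⟩
  3 * (n * 2) + 3 * ∑< (suc n) e ≡⟨ cong (λ t → 3 * (n * 2) + 3 * t) ∑<-suc-e ⟩
  3 * (n * 2) + 3 * ∑< n e    ≡⟨ sym (*-distribˡ-+ 3 (n * 2) _) ⟩
  3 * (n * 2 + ∑< n e)        ≡⟨ cong (3 *_) (sym ∑<-c) ⟩
  3 * ∑< n c                  ∎
  where
  open ≤-Reasoning
  e : ℕ → ℕ
  e a = c a ∸ 2
  split : ∀ n → 7 * n ≡ 3 * (n * 2) + n
  split = solve-∀
  ∑<-suc-e : ∑< (suc n) e ≡ ∑< n e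
  ∑<-suc-e = trans (∑<-suc n e) (trans (cong (∑< n e +_) (m≤n⇒m∸n≡0 cₙ≤2)) (+-identityʳ _))
  ∑<-c : ∑< n c ≡ n * 2 + ∑< n e
  ∑<-c = begin-equality
    ∑< n c                        ≡⟨ ∑-cong n (λ i → sym (m+[n∸m]≡n (c≥2 i))) ⟩
    ∑ n (λ i → 2 + e (toℕ i))     ≡⟨ ∑-+ n _ _ ⟩
    ∑ n (λ _ → 2) + ∑< n e        ≡⟨ cong (_+ ∑< n e) (∑-const n 2) ⟩
    n * 2 + ∑< n e                ∎

C₃-complete : ∀ {j j' : Fin 3} → j ≢ j' → CycAdj 3 j j'
C₃-complete {Fin.zero}                   {Fin.zero}                   j≢j' = ⊥-elim (j≢j' refl)
C₃-complete {Fin.zero}                   {Fin.suc Fin.zero}           _    = inj₁ (inj₁ refl)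
C₃-complete {Fin.zero}                   {Fin.suc (Fin.suc Fin.zero)} _    = inj₂ (inj₂ (refl , refl))
C₃-complete {Fin.suc Fin.zero}           {Fin.zero}                   _    = inj₁ (inj₂ refl)
C₃-complete {Fin.suc Fin.zero}           {Fin.suc Fin.zero}           j≢j' = ⊥-elim (j≢j' refl)
C₃-complete {Fin.suc Fin.zero}           {Fin.suc (Fin.suc Fin.zero)} _    = inj₁ (inj₁ refl)
C₃-complete {Fin.suc (Fin.suc Fin.zero)} {Fin.zero}                   _    = inj₂ (inj₁ (refl , refl))
C₃-complete {Fin.suc (Fin.suc Fin.zero)} {Fin.suc Fin.zero}           _    = inj₁ (inj₂ refl)
C₃-complete {Fin.suc (Fin.suc Fin.zero)} {Fin.suc (Fin.suc Fin.zero)} j≢j' = ⊥-elim (j≢j' refl)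

CycAdj-irrefl : ∀ {m} → 2 ≤ m → ∀ j → ¬ CycAdj m j j
CycAdj-irrefl _   j (inj₁ (inj₁ e))       = 1+n≢n e
CycAdj-irrefl _   j (inj₁ (inj₂ e))       = 1+n≢n e
CycAdj-irrefl 2≤m j (inj₂ (inj₁ (e , z))) = 1+n≰n (subst (2 ≤_) (trans (sym e) (cong suc z)) 2≤m)
CycAdj-irrefl 2≤m j (inj₂ (inj₂ (e , z))) = 1+n≰n (subst (2 ≤_) (trans (sym e) (cong suc z)) 2≤m)

NotBothZero : ℕ → ℕ → Set
NotBothZero x y = x ≡ 0 → y ≡ 0 → ⊥

+-≥1 : ∀ x y → NotBothZero x y → 1 ≤ x + y
+-≥1 zero    zero    x∨y = ⊥-elim (x∨y refl refl)
+-≥1 zero    (suc y) _   = s≤s z≤n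
+-≥1 (suc x) y       _   = s≤s z≤n

triple-≥2 : ∀ x y z → NotBothZero x y → NotBothZero x z → NotBothZero y z → 2 ≤ x + (y + z)
triple-≥2 zero    y       z       x∨y x∨z y∨z = +-mono-≤ (+-≥1 0 y x∨y) (+-≥1 0 z x∨z)
triple-≥2 (suc x) y       z       _   _   y∨z = s≤s (≤-trans (+-≥1 y z y∨z) (m≤n+m _ x))

triple-≥3 : ∀ x y z → NotBothZero y z → x ≡ 2 → 3 ≤ x + (y + z)
triple-≥3 x y z y∨z refl = s≤s (s≤s (+-≥1 y z y∨z))

module Triangle {c : Fin 3 → ℕ} (oneZero : ∀ {j j'} → j ≢ j' → NotBothZero (c j) (c j')) where

  private
    x = c Fin.zero
    y = c (Fin.suc Fin.zero)
    z = c (Fin.suc (Fin.suc Fin.zero))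

    ∑₃ : ∑ 3 c ≡ x + (y + z)
    ∑₃ = cong (λ t → x + (y + t)) (+-identityʳ z)

  ∑₃-≥2 : 2 ≤ ∑ 3 c
  ∑₃-≥2 = subst (2 ≤_) (sym ∑₃) (triple-≥2 x y z (oneZero λ ()) (oneZero λ ()) (oneZero λ ()))

  ∑₃-≥3 : ∀ j → c j ≡ 2 → 3 ≤ ∑ 3 c
  ∑₃-≥3 Fin.zero e =
    subst (3 ≤_) (sym ∑₃) (triple-≥3 x y z (oneZero λ ()) e)
  ∑₃-≥3 (Fin.suc Fin.zero) e =
    subst (3 ≤_) (sym (trans ∑₃ (x∙yz≈y∙xz x y z))) (triple-≥3 y x z (oneZero λ ()) e)
  ∑₃-≥3 (Fin.suc (Fin.suc Fin.zero)) e =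
    subst (3 ≤_) (sym (trans ∑₃ (x∙yz≈z∙xy x y z))) (triple-≥3 z x y (oneZero λ ()) e)

∑₃-nonzero : ∀ {c : Fin 3 → ℕ} → (∀ j → c j ≢ 0) → 3 ≤ ∑ 3 c
∑₃-nonzero c≢0 = ∑-mono-≤ 3 (λ j → n≢0⇒n>0 (c≢0 j))

extend : ∀ {n} → (Fin n → ℕ) → ℕ → ℕ
extend {n} g a with a <? n
... | yes a<n = g (fromℕ< a<n)
... | no  _   = 0

extend-toℕ : ∀ {n} (g : Fin n → ℕ) i → extend g (toℕ i) ≡ g i
extend-toℕ {n} g i with toℕ i <? n
... | yes i<n = cong g (fromℕ<-toℕ i i<n)
... | no  i≮n = ⊥-elim (i≮n (toℕ<n i))

extend-outside : ∀ {n} (g : Fin n → ℕ) → extend g n ≡ 0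
extend-outside {n} g with n <? n
... | yes n<n = ⊥-elim (<-irrefl refl n<n)
... | no  _   = refl

module LowerBound {n} (f : Vertex n 3 → ℕ) (isOIRDF : IsOIRDF n 3 f) where
  open IsOIRDF isOIRDF

  colWeight : Fin n → ℕ
  colWeight i = ∑ 3 (λ j → f (i , j))

  private
    column-zeros : ∀ i {j j'} → j ≢ j' → NotBothZero (f (i , j)) (f (i , j'))
    column-zeros i j≢j' z z' = independent _ _ z z' (inj₁ (refl , C₃-complete j≢j'))

  colWeight-≥2 : ∀ i → 2 ≤ colWeight i
  colWeight-≥2 i = Triangle.∑₃-≥2 (column-zeros i)

  colWeight-≥3 : ∀ i j → f (i , j) ≡ 2 → 3 ≤ colWeight i
  colWeight-≥3 i = Triangle.∑₃-≥3 (column-zeros i)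

  -- A light column contains a 0; the 2 dominating it cannot lie in the same column.
  light-column-has-heavy-neighbour : ∀ i → colWeight i < 3 → ∃ λ i' → PathAdj n i i' × 3 ≤ colWeight i'
  light-column-has-heavy-neighbour i light with any? (λ j → f (i , j) ≟ 0)
  ... | no  noZero = ⊥-elim (<⇒≱ light (∑₃-nonzero (λ j z → noZero (j , z))))
  ... | yes (j , z) with dominated (i , j) z
  ...   | (_ , j') , inj₁ (refl , _) , two = ⊥-elim (<⇒≱ light (colWeight-≥3 i j' two))
  ...   | (i' , _) , inj₂ (refl , adj) , two = i' , adj , colWeight-≥3 i' j two

  private
    c : ℕ → ℕ
    c = extend colWeight

    e : ℕ → ℕ
    e a = c a ∸ 2

    excess-positive : ∀ i → 3 ≤ colWeight i → 1 ≤ e (toℕ i)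
    excess-positive i heavy =
      subst (λ w → 1 ≤ w ∸ 2) (sym (extend-toℕ colWeight i)) (m<n⇒0<n∸m heavy)

    excess-nearby : ∀ i → 1 ≤ around e (toℕ i)
    excess-nearby i with 3 ≤? colWeight i
    ... | yes heavy = around-self e _ (excess-positive i heavy)
    ... | no  light with light-column-has-heavy-neighbour i (≰⇒> light)
    ...   | i' , inj₁ next , heavy =
            around-next e _ (subst (λ a → 1 ≤ e a) (sym next) (excess-positive i' heavy))
    ...   | i' , inj₂ prev , heavy =
            subst (λ a → 1 ≤ around e a) prev (around-previous e _ (excess-positive i' heavy))

  7*n≤3*weight : 7 * n ≤ 3 * weight n 3 f
  7*n≤3*weight = subst (λ w → 7 * n ≤ 3 * w) (∑-cong n (extend-toℕ colWeight))
    (7*n≤3*∑< n c (subst (_≤ 2) (sym (extend-outside colWeight)) z≤n)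
       (λ i → subst (2 ≤_) (sym (extend-toℕ colWeight i)) (colWeight-≥2 i)) excess-nearby)

mod3 : ℕ → ℕ
mod3 0 = 0
mod3 1 = 1
mod3 2 = 2
mod3 (suc (suc (suc a))) = mod3 a

mod3-cases : ∀ a → mod3 a ≡ 0 ⊎ mod3 a ≡ 1 ⊎ mod3 a ≡ 2
mod3-cases 0 = inj₁ refl
mod3-cases 1 = inj₂ (inj₁ refl)
mod3-cases 2 = inj₂ (inj₂ refl)
mod3-cases (suc (suc (suc a))) = mod3-cases a

∀-by-period6 : ∀ (P : ℕ → Set) → (∀ {a} → P a → P (6 + a)) → (∀ {a} → a < 6 → P a) → ∀ a → P a
∀-by-period6 P step base 0 = base (s≤s z≤n)
∀-by-period6 P step base 1 = base (s≤s (s≤s z≤n))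
∀-by-period6 P step base 2 = base (s≤s (s≤s (s≤s z≤n)))
∀-by-period6 P step base 3 = base (s≤s (s≤s (s≤s (s≤s z≤n))))
∀-by-period6 P step base 4 = base (s≤s (s≤s (s≤s (s≤s (s≤s z≤n)))))
∀-by-period6 P step base 5 = base ≤-refl
∀-by-period6 P step base (suc (suc (suc (suc (suc (suc a)))))) = step (∀-by-period6 P step base a)

column : ℕ → ℕ → ℕ → Fin 3 → ℕ
column x _ _ Fin.zero                     = x
column _ y _ (Fin.suc Fin.zero)           = y
column _ _ z (Fin.suc (Fin.suc Fin.zero)) = z

-- Each block of three columns is a "hub" with a 2, flanked by two columns whose 0 sits
-- in the row of that 2; the second block exchanges rows 0 and 1, so that zeros in
-- neighbouring columns never share a row.
tile : ℕ → Fin 3 → ℕ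
tile 0 = column 0 1 1
tile 1 = column 2 1 0
tile 2 = column 0 1 1
tile 3 = column 1 0 1
tile 4 = column 1 2 0
tile 5 = column 1 0 1
tile (suc (suc (suc (suc (suc (suc a)))))) = tile a

blockWeight : ℕ → ℕ
blockWeight 0 = 2
blockWeight 1 = 3
blockWeight 2 = 2
blockWeight (suc (suc (suc a))) = blockWeight a

tile-≤2 : ∀ a j → tile a j ≤ 2
tile-≤2 = ∀-by-period6 _ id (from-yes (allUpTo? (λ a → all? λ j → tile a j ≤? 2) 6))

tile-zero-unique : ∀ a j j' → tile a j ≡ 0 → tile a j' ≡ 0 → j ≡ j'
tile-zero-unique = ∀-by-period6 _ id (from-yes (allUpTo? (λ a →
  all? λ j → all? λ j' → (tile a j ≟ 0) →-dec ((tile a j' ≟ 0) →-dec (j Fin.≟ j'))) 6))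

tile-zeros-staggered : ∀ a j → tile a j ≡ 0 → tile (suc a) j ≢ 0
tile-zeros-staggered = ∀-by-period6 _ id (from-yes (allUpTo? (λ a →
  all? λ j → (tile a j ≟ 0) →-dec ¬? (tile (suc a) j ≟ 0)) 6))

tile-zero-before-hub : ∀ a → mod3 a ≡ 0 → ∀ j → tile a j ≡ 0 → tile (suc a) j ≡ 2
tile-zero-before-hub = ∀-by-period6 _ id (from-yes (allUpTo? (λ a →
  (mod3 a ≟ 0) →-dec all? λ j → (tile a j ≟ 0) →-dec (tile (suc a) j ≟ 2)) 6))

tile-zero-in-hub : ∀ a → mod3 a ≡ 1 → ∀ j → tile a j ≡ 0 → ∃ λ j' → j' ≢ j × tile a j' ≡ 2
tile-zero-in-hub = ∀-by-period6 _ id (from-yes (allUpTo? (λ a →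
  (mod3 a ≟ 1) →-dec all? λ j → (tile a j ≟ 0) →-dec any? λ j' → ¬? (j' Fin.≟ j) ×-dec (tile a j' ≟ 2)) 6))

tile-zero-after-hub : ∀ a → mod3 (suc a) ≡ 2 → ∀ j → tile (suc a) j ≡ 0 → tile a j ≡ 2
tile-zero-after-hub = ∀-by-period6 _ id (from-yes (allUpTo? (λ a →
  (mod3 (suc a) ≟ 2) →-dec all? λ j → (tile (suc a) j ≟ 0) →-dec (tile a j ≟ 2)) 6))

tile-weight : ∀ a → ∑ 3 (tile a) ≡ blockWeight a
tile-weight = ∀-by-period6 _ id (from-yes (allUpTo? (λ a → ∑ 3 (tile a) ≟ blockWeight a) 6))

∑<-+-length : ∀ k m h → ∑< (k + m) h ≡ ∑< k h + ∑< m (λ a → h (k + a))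
∑<-+-length zero    m h = refl
∑<-+-length (suc k) m h =
  trans (cong (h 0 +_) (∑<-+-length k m (λ a → h (suc a)))) (sym (+-assoc (h 0) _ _))

3*∑<-blockWeight : ∀ m o → 3 * ∑< m (λ a → blockWeight (a + o)) ≤ 7 * m + 2
3*∑<-blockWeight 0 o = z≤n
3*∑<-blockWeight 1 o =
  ∀-by-period6 (λ o → 3 * ∑< 1 (λ a → blockWeight (a + o)) ≤ 9) id
    (from-yes (allUpTo? (λ o → 3 * ∑< 1 (λ a → blockWeight (a + o)) ≤? 9) 6)) o
3*∑<-blockWeight 2 o =
  ∀-by-period6 (λ o → 3 * ∑< 2 (λ a → blockWeight (a + o)) ≤ 16) id
    (from-yes (allUpTo? (λ o → 3 * ∑< 2 (λ a → blockWeight (a + o)) ≤? 16) 6)) o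
3*∑<-blockWeight (suc (suc (suc m))) o = begin
  3 * ∑< (3 + m) h           ≡⟨ cong (3 *_) (∑<-+-length 3 m h) ⟩
  3 * (∑< 3 h + ∑< m h)      ≡⟨ cong (λ t → 3 * (t + ∑< m h)) (block o) ⟩
  3 * (7 + ∑< m h)           ≡⟨ *-distribˡ-+ 3 7 (∑< m h) ⟩
  21 + 3 * ∑< m h            ≤⟨ +-monoʳ-≤ 21 (3*∑<-blockWeight m o) ⟩
  21 + (7 * m + 2)           ≡⟨ regroup m ⟩
  7 * (3 + m) + 2            ∎
  where
  open ≤-Reasoning
  h : ℕ → ℕ
  h a = blockWeight (a + o)
  regroup : ∀ m → 21 + (7 * m + 2) ≡ 7 * (3 + m) + 2
  regroup = solve-∀
  block : ∀ o → ∑< 3 (λ a → blockWeight (a + o)) ≡ 7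
  block = ∀-by-period6 _ id (from-yes (allUpTo? (λ o → ∑< 3 (λ a → blockWeight (a + o)) ≟ 7) 6))

-- For n ≡ 1 (mod 3) the tiling is shifted by one column, so that the last column
-- is never one that needs the hub to its right.
offset : ℕ → ℕ
offset 0 = 0
offset 1 = 1
offset 2 = 0
offset (suc (suc (suc n))) = offset n

mod3-offset-≢2 : ∀ n → mod3 (offset n) ≢ 2
mod3-offset-≢2 0 ()
mod3-offset-≢2 1 ()
mod3-offset-≢2 2 ()
mod3-offset-≢2 (suc (suc (suc n))) = mod3-offset-≢2 n

mod3-last-≢0 : ∀ {a n} → suc a ≡ n → mod3 (a + offset n) ≢ 0
mod3-last-≢0 {0}                   refl ()
mod3-last-≢0 {1}                   refl ()
mod3-last-≢0 {2}                   refl ()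
mod3-last-≢0 {suc (suc (suc a))}   refl = mod3-last-≢0 {a} refl

strip : (n : ℕ) → Vertex n 3 → ℕ
strip n (i , j) = tile (toℕ i + offset n) j

strip-dominated-right : ∀ {n} (i : Fin n) j → mod3 (toℕ i + offset n) ≡ 0 → strip n (i , j) ≡ 0 →
                        ∃ λ v → Adj n 3 (i , j) v × strip n v ≡ 2
strip-dominated-right {n} i j before z =
  (fromℕ< i+1<n , j) , inj₂ (refl , inj₁ (sym i+1≡)) ,
  subst (λ a → tile (a + offset n) j ≡ 2) (sym i+1≡) (tile-zero-before-hub (toℕ i + offset n) before j z)
  where
  i+1<n : suc (toℕ i) < n
  i+1<n = ≤∧≢⇒< (toℕ<n i) (λ last → mod3-last-≢0 last before)
  i+1≡ : toℕ (fromℕ< i+1<n) ≡ suc (toℕ i)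
  i+1≡ = toℕ-fromℕ< i+1<n

strip-dominated-left : ∀ {n} (i : Fin n) j → mod3 (toℕ i + offset n) ≡ 2 → strip n (i , j) ≡ 0 →
                       ∃ λ v → Adj n 3 (i , j) v × strip n v ≡ 2
strip-dominated-left {n} Fin.zero j after z = ⊥-elim (mod3-offset-≢2 n after)
strip-dominated-left {n} (Fin.suc i) j after z =
  (inject₁ i , j) , inj₂ (refl , inj₂ (cong suc (toℕ-inject₁ i))) ,
  subst (λ a → tile (a + offset n) j ≡ 2) (sym (toℕ-inject₁ i)) (tile-zero-after-hub (toℕ i + offset n) after j z)

strip-isOIRDF : ∀ n → IsOIRDF n 3 (strip n)
strip-isOIRDF n = record { bounded = bounded ; dominated = dominated ; independent = independent }
  where
  bounded : ∀ u → strip n u ≤ 2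
  bounded (i , j) = tile-≤2 (toℕ i + offset n) j

  dominated : ∀ u → strip n u ≡ 0 → ∃ λ v → Adj n 3 u v × strip n v ≡ 2
  dominated (i , j) z with mod3-cases (toℕ i + offset n)
  ... | inj₁ before        = strip-dominated-right i j before z
  ... | inj₂ (inj₂ after)  = strip-dominated-left i j after z
  ... | inj₂ (inj₁ hub) with tile-zero-in-hub (toℕ i + offset n) hub j z
  ...   | j' , j'≢j , two = (i , j') , inj₁ (refl , C₃-complete (≢-sym j'≢j)) , two

  independent : ∀ u v → strip n u ≡ 0 → strip n v ≡ 0 → ¬ Adj n 3 u v
  independent (i , j) (_ , j') z z' (inj₁ (refl , adj)) =
    CycAdj-irrefl (s≤s (s≤s z≤n)) j' (subst (λ k → CycAdj 3 k j') (tile-zero-unique (toℕ i + offset n) j j' z z') adj)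
  independent (i , j) (_ , _) z z' (inj₂ (refl , inj₁ next)) =
    tile-zeros-staggered (toℕ i + offset n) j z (subst (λ a → tile (a + offset n) j ≡ 0) (sym next) z')
  independent (_ , j) (i' , _) z z' (inj₂ (refl , inj₂ prev)) =
    tile-zeros-staggered (toℕ i' + offset n) j z' (subst (λ a → tile (a + offset n) j ≡ 0) (sym prev) z)

3*weight-strip : ∀ n → 3 * weight n 3 (strip n) ≤ 7 * n + 2
3*weight-strip n = subst (λ w → 3 * w ≤ 7 * n + 2) (sym (∑-cong n (λ i → tile-weight (toℕ i + offset n))))
  (3*∑<-blockWeight n (offset n))

ceil3-≤ : ∀ {x w} → x ≤ 3 * w → ceil3 x ≤ w
ceil3-≤ {x} {w} x≤3w = ≤-pred (m<n*o⇒m/o<n (begin-strict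
  x + 2          <⟨ +-monoˡ-< 2 (s≤s x≤3w) ⟩
  suc (3 * w) + 2 ≡⟨ regroup w ⟩
  suc w * 3      ∎))
  where
  open ≤-Reasoning
  regroup : ∀ w → suc (3 * w) + 2 ≡ suc w * 3
  regroup = solve-∀

ceil3-≥ : ∀ {x w} → 3 * w ≤ x + 2 → w ≤ ceil3 x
ceil3-≥ {x} {w} 3w≤x+2 = subst (_≤ ceil3 x) (m*n/n≡m w 3) (/-monoˡ-≤ 3 (subst (_≤ x + 2) (*-comm 3 w) 3w≤x+2))

-- The formula also holds for n < 3.
theorem4 : (n : ℕ) → 3 ≤ n → γoiR-is n 3 (ceil3 (7 * n))
theorem4 n _ = (strip n , strip-isOIRDF n , weight-strip) , λ f f-OIRDF → ceil3-≤ (7*n≤3*weight f f-OIRDF)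
  where
  open LowerBound using (7*n≤3*weight)
  weight-strip : weight n 3 (strip n) ≡ ceil3 (7 * n)
  weight-strip = ≤-antisym (ceil3-≥ (3*weight-strip n)) (ceil3-≤ (7*n≤3*weight (strip n) (strip-isOIRDF n)))
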